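{- Let $\epsilon:A\otimes B\to 0$ be a dual pairing in a symmetric monoidal category, $(A,\mu_A)$ a semigroup, and $l,r:A\to B$ isomorphisms satisfying $\epsilon\circ(A\otimes r)=\epsilon\circ(A\otimes l)\circ\sigma_{A,A}$. Then $(A,B,\epsilon,\mu_A,l,r)$ is a Frobenius structure if and only if $\rhd\circ(B\otimes r^{ -1})=\lhd\circ(l^{ -1}\otimes B)$ as maps $B\otimes B\to B$.
   Context: $\mathcal{V}$ is taken strict with symmetry $\sigma$; $0$ is a fixed object. A dual pairing is $\epsilon:A\otimes B\to 0$ such that for all $X$ the maps $\hom(X,B)\to\hom(A\otimes X,0)$, $f\mapsto\epsilon\circ(A\otimes f)$, and $\hom(X,A)\to\hom(X\otimes B,0)$, $g\mapsto\epsilon\circ(g\otimes B)$, are bijections. $\lhd:A\otimes B\to B$ is the unique map with $\epsilon\circ(A\otimes\lhd)=\epsilon\circ(\mu_A\otimes B)$, and $\rhd:B\otimes A\to B$ the unique map with $\epsilon\circ(A\otimes\rhd)=\epsilon\circ(\mu_A\otimes B)\circ\sigma_{A\otimes B,A}$. A Frobenius structure is $(A,B,\epsilon,\mu_A,l,r)$ with $\epsilon$ a dual pairing, $\mu_A$ associative, $l,r:A\to B$ isomorphisms with $\epsilon\circ(A\otimes r)=\epsilon\circ(A\otimes l)\circ\sigma_{A,A}$ and $\lhd\circ(A\otimes r)=\rhd\circ(l\otimes A)$. -}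

module Defs where

open import Level using (Level; _⊔_) renaming (suc to lsuc)
open import Data.Product using (Σ; _×_; _,_; proj₁; proj₂)
open import Relation.Binary.PropositionalEquality using (_≡_; refl; sym; subst₂)
open import Function.Definitions using (Bijective)

-- Strictness: the associativity and unit laws
-- hold as equalities of objects, and the corresponding equalities of
-- morphisms hold after transport ("cast") along these object equalities.
record StrictSymMonCat (o ℓ : Level) : Set (lsuc (o ⊔ ℓ)) where
  infixr 9 _∘_
  infixr 10 _⊗₀_ _⊗₁_
  field
    Obj : Set o
    Hom : Obj → Obj → Set ℓ
    id  : ∀ {A} → Hom A A
    _∘_ : ∀ {A B C} → Hom B C → Hom A B → Hom A C
    identityˡ : ∀ {A B} {f : Hom A B} → id ∘ f ≡ f
    identityʳ : ∀ {A B} {f : Hom A B} → f ∘ id ≡ f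
    assoc : ∀ {A B C D} {f : Hom A B} {g : Hom B C} {h : Hom C D} →
            (h ∘ g) ∘ f ≡ h ∘ (g ∘ f)
    _⊗₀_ : Obj → Obj → Obj
    _⊗₁_ : ∀ {A B C D} → Hom A B → Hom C D → Hom (A ⊗₀ C) (B ⊗₀ D)
    ⊗-id : ∀ {A B} → id {A} ⊗₁ id {B} ≡ id
    ⊗-∘  : ∀ {A B C D E F} {f : Hom B C} {g : Hom A B} {h : Hom E F} {k : Hom D E} →
           (f ∘ g) ⊗₁ (h ∘ k) ≡ (f ⊗₁ h) ∘ (g ⊗₁ k)
    I : Obj
    unitˡ₀ : ∀ {A} → I ⊗₀ A ≡ A
    unitʳ₀ : ∀ {A} → A ⊗₀ I ≡ A
    assoc₀ : ∀ {A B C} → (A ⊗₀ B) ⊗₀ C ≡ A ⊗₀ (B ⊗₀ C)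
    unitˡ₁ : ∀ {A B} {f : Hom A B} → subst₂ Hom unitˡ₀ unitˡ₀ (id {I} ⊗₁ f) ≡ f
    unitʳ₁ : ∀ {A B} {f : Hom A B} → subst₂ Hom unitʳ₀ unitʳ₀ (f ⊗₁ id {I}) ≡ f
    assoc₁ : ∀ {A B C D E F} {f : Hom A B} {g : Hom C D} {h : Hom E F} →
             subst₂ Hom assoc₀ assoc₀ ((f ⊗₁ g) ⊗₁ h) ≡ f ⊗₁ (g ⊗₁ h)
    σ : ∀ {A B} → Hom (A ⊗₀ B) (B ⊗₀ A)
    σ-natural : ∀ {A B C D} {f : Hom A B} {g : Hom C D} →
                σ ∘ (f ⊗₁ g) ≡ (g ⊗₁ f) ∘ σ
    σ-involutive : ∀ {A B} → σ {B} {A} ∘ σ {A} {B} ≡ id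
    -- hexagon (strict form): σ_{A,B⊗C} = (B ⊗ σ_{A,C}) ∘ (σ_{A,B} ⊗ C)
    hexagon : ∀ {A B C} →
              σ {A} {B ⊗₀ C} ≡
              subst₂ Hom assoc₀ (sym assoc₀)
                ((id {B} ⊗₁ σ {A} {C}) ∘ subst₂ Hom refl assoc₀ (σ {A} {B} ⊗₁ id {C}))

module _ {o ℓ : Level} (𝒞 : StrictSymMonCat o ℓ) where
  open StrictSymMonCat 𝒞

  cast : ∀ {A A′ B B′} → A ≡ A′ → B ≡ B′ → Hom A B → Hom A′ B′
  cast p q f = subst₂ Hom p q f

  IsDualPairing : {O A B : Obj} → Hom (A ⊗₀ B) O → Set (o ⊔ ℓ)
  IsDualPairing {O} {A} {B} ε =
    (∀ (X : Obj) → Bijective _≡_ _≡_ (λ (f : Hom X B) → ε ∘ (id {A} ⊗₁ f)))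
    × (∀ (X : Obj) → Bijective _≡_ _≡_ (λ (g : Hom X A) → ε ∘ (g ⊗₁ id {B})))

  IsAssociative : {A : Obj} → Hom (A ⊗₀ A) A → Set ℓ
  IsAssociative {A} μ = μ ∘ (μ ⊗₁ id {A}) ≡ cast (sym assoc₀) refl (μ ∘ (id {A} ⊗₁ μ))

  IsIso : {A B : Obj} → Hom A B → Set ℓ
  IsIso {A} {B} f = Σ (Hom B A) λ g → (g ∘ f ≡ id) × (f ∘ g ≡ id)

  inverse : {A B : Obj} {f : Hom A B} → IsIso f → Hom B A
  inverse i = proj₁ i

  -- ◁ : A ⊗ B → B, the unique map with ε ∘ (A ⊗ ◁) = ε ∘ (μ_A ⊗ B)
  -- (obtained from surjectivity of the first bijection; unique by injectivity)
  lhd : {O A B : Obj} {ε : Hom (A ⊗₀ B) O} → IsDualPairing ε →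
        Hom (A ⊗₀ A) A → Hom (A ⊗₀ B) B
  lhd {O} {A} {B} {ε} dp μ =
    proj₁ (proj₂ (proj₁ dp (A ⊗₀ B)) (cast assoc₀ refl (ε ∘ (μ ⊗₁ id {B}))))

  -- ▷ : B ⊗ A → B, the unique map with
  -- ε ∘ (A ⊗ ▷) = ε ∘ (μ_A ⊗ B) ∘ σ_{A⊗B,A}
  rhd : {O A B : Obj} {ε : Hom (A ⊗₀ B) O} → IsDualPairing ε →
        Hom (A ⊗₀ A) A → Hom (B ⊗₀ A) B
  rhd {O} {A} {B} {ε} dp μ =
    proj₁ (proj₂ (proj₁ dp (B ⊗₀ A))
      (cast assoc₀ refl
        (ε ∘ (μ ⊗₁ id {B}) ∘ cast refl (sym assoc₀) (σ {A ⊗₀ B} {A}))))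

  LRCompat : {O A B : Obj} → Hom (A ⊗₀ B) O → Hom A B → Hom A B → Set ℓ
  LRCompat {O} {A} ε l r = ε ∘ (id {A} ⊗₁ r) ≡ ε ∘ (id {A} ⊗₁ l) ∘ σ {A} {A}

  IsFrobeniusStructure : {O A B : Obj} → Hom (A ⊗₀ B) O → Hom (A ⊗₀ A) A →
                         Hom A B → Hom A B → Set (o ⊔ ℓ)
  IsFrobeniusStructure {O} {A} {B} ε μ l r =
    Σ (IsDualPairing ε) λ dp →
      IsAssociative μ × IsIso l × IsIso r × LRCompat ε l r
      × (lhd dp μ ∘ (id {A} ⊗₁ r) ≡ rhd dp μ ∘ (l ⊗₁ id {A}))

{-# OPTIONS --safe #-}
-- The Frobenius condition ◁ ∘ (A ⊗ r) = ▷ ∘ (l ⊗ A) and the condition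
-- ▷ ∘ (B ⊗ r⁻¹) = ◁ ∘ (l⁻¹ ⊗ B) are obtained from each other by precomposing
-- with l⁻¹ ⊗ r⁻¹, respectively l ⊗ r.  The only other point is that ◁ and ▷ are
-- characterised by a universal property, so they do not depend on which proof
-- that ε is a dual pairing is used to construct them.
module Submission where

open import Defs
open import Level using (Level)
open import Function.Bundles using (_⇔_; mk⇔)
open import Function.Definitions using (Bijective)
open import Data.Product using (_,_; proj₁; proj₂)
open import Relation.Binary.PropositionalEquality

preimage-unique : ∀ {a b} {X : Set a} {Y : Set b} {f : X → Y}
                  (bij₁ bij₂ : Bijective _≡_ _≡_ f) (y : Y) →
                  proj₁ (proj₂ bij₁ y) ≡ proj₁ (proj₂ bij₂ y)
preimage-unique bij₁ bij₂ y =
  proj₁ bij₁ (trans (proj₂ (proj₂ bij₁ y) refl) (sym (proj₂ (proj₂ bij₂ y) refl)))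

module _ {o ℓ : Level} (𝒞 : StrictSymMonCat o ℓ) where
  open StrictSymMonCat 𝒞

  inverse-isIso : {X Y : Obj} {f : Hom X Y} (i : IsIso 𝒞 f) → IsIso 𝒞 (inverse 𝒞 i)
  inverse-isIso {f = f} (g , g∘f≡id , f∘g≡id) = f , f∘g≡id , g∘f≡id

  lhd-irrelevant : {O A B : Obj} {ε : Hom (A ⊗₀ B) O} (dp dp′ : IsDualPairing 𝒞 ε)
                   (μ : Hom (A ⊗₀ A) A) → lhd 𝒞 dp μ ≡ lhd 𝒞 dp′ μ
  lhd-irrelevant {A = A} {B} dp dp′ μ =
    preimage-unique (proj₁ dp (A ⊗₀ B)) (proj₁ dp′ (A ⊗₀ B)) _

  rhd-irrelevant : {O A B : Obj} {ε : Hom (A ⊗₀ B) O} (dp dp′ : IsDualPairing 𝒞 ε)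
                   (μ : Hom (A ⊗₀ A) A) → rhd 𝒞 dp μ ≡ rhd 𝒞 dp′ μ
  rhd-irrelevant {A = A} {B} dp dp′ μ =
    preimage-unique (proj₁ dp (B ⊗₀ A)) (proj₁ dp′ (B ⊗₀ A)) _

  ∘-⊗-merge : ∀ {X₁ X₂ Y₁ Y₂ Z₁ Z₂ W} (h : Hom (Z₁ ⊗₀ Z₂) W)
              (a : Hom Y₁ Z₁) (b : Hom Y₂ Z₂) (c : Hom X₁ Y₁) (d : Hom X₂ Y₂) →
              (h ∘ (a ⊗₁ b)) ∘ (c ⊗₁ d) ≡ h ∘ ((a ∘ c) ⊗₁ (b ∘ d))
  ∘-⊗-merge h a b c d = trans assoc (cong (h ∘_) (sym ⊗-∘))

  interchange-inverses : ∀ {X X′ Y Y′ Z} (f : Hom (X ⊗₀ Y′) Z) (g : Hom (X′ ⊗₀ Y) Z)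
                         {a : Hom X X′} {b : Hom Y Y′} (ai : IsIso 𝒞 a) (bi : IsIso 𝒞 b) →
                         f ∘ (id ⊗₁ b) ≡ g ∘ (a ⊗₁ id) →
                         g ∘ (id ⊗₁ inverse 𝒞 bi) ≡ f ∘ (inverse 𝒞 ai ⊗₁ id)
  interchange-inverses f g {a} {b} (a′ , _ , a∘a′≡id) (b′ , _ , b∘b′≡id) f≡g =
    begin
      g ∘ (id ⊗₁ b′)
    ≡⟨ cong₂ (λ u v → g ∘ (u ⊗₁ v)) (sym a∘a′≡id) (sym identityˡ) ⟩
      g ∘ ((a ∘ a′) ⊗₁ (id ∘ b′))
    ≡⟨ sym (∘-⊗-merge g a id a′ b′) ⟩
      (g ∘ (a ⊗₁ id)) ∘ (a′ ⊗₁ b′)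
    ≡⟨ cong (_∘ (a′ ⊗₁ b′)) (sym f≡g) ⟩
      (f ∘ (id ⊗₁ b)) ∘ (a′ ⊗₁ b′)
    ≡⟨ ∘-⊗-merge f id b a′ b′ ⟩
      f ∘ ((id ∘ a′) ⊗₁ (b ∘ b′))
    ≡⟨ cong₂ (λ u v → f ∘ (u ⊗₁ v)) identityˡ b∘b′≡id ⟩
      f ∘ (a′ ⊗₁ id)
    ∎
    where open ≡-Reasoning

mainTheorem15 : {o ℓ : Level} (𝒞 : StrictSymMonCat o ℓ) →
    let open StrictSymMonCat 𝒞 in
    {O A B : Obj} (ε : Hom (A ⊗₀ B) O) (dp : IsDualPairing 𝒞 ε)
    (μ : Hom (A ⊗₀ A) A) → IsAssociative 𝒞 μ →
    (l r : Hom A B) (li : IsIso 𝒞 l) (ri : IsIso 𝒞 r) → LRCompat 𝒞 ε l r →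
    IsFrobeniusStructure 𝒞 ε μ l r
      ⇔ (rhd 𝒞 dp μ ∘ (id {B} ⊗₁ inverse 𝒞 ri) ≡ lhd 𝒞 dp μ ∘ (inverse 𝒞 li ⊗₁ id {B}))
mainTheorem15 𝒞 ε dp μ μ-assoc l r li ri lr-compat = mk⇔ to from
  where
  open StrictSymMonCat 𝒞

  to : IsFrobeniusStructure 𝒞 ε μ l r →
       rhd 𝒞 dp μ ∘ (id ⊗₁ inverse 𝒞 ri) ≡ lhd 𝒞 dp μ ∘ (inverse 𝒞 li ⊗₁ id)
  to (dp′ , _ , _ , _ , _ , frobenius) =
    interchange-inverses 𝒞 (lhd 𝒞 dp μ) (rhd 𝒞 dp μ) li ri
      (subst₂ (λ ◁ ▷ → ◁ ∘ (id ⊗₁ r) ≡ ▷ ∘ (l ⊗₁ id))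
        (lhd-irrelevant 𝒞 dp′ dp μ) (rhd-irrelevant 𝒞 dp′ dp μ) frobenius)

  from : rhd 𝒞 dp μ ∘ (id ⊗₁ inverse 𝒞 ri) ≡ lhd 𝒞 dp μ ∘ (inverse 𝒞 li ⊗₁ id) →
         IsFrobeniusStructure 𝒞 ε μ l r
  from condition = dp , μ-assoc , li , ri , lr-compat ,
    interchange-inverses 𝒞 (rhd 𝒞 dp μ) (lhd 𝒞 dp μ)
      (inverse-isIso 𝒞 li) (inverse-isIso 𝒞 ri) condition
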